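{- Let $X_1,X_2,X_3$ be pairwise disjoint vertex subsets of $G_3$ with $V(G_3)=X_1\cup X_2\cup X_3$ and $|X_1|\ge|X_2|\ge|X_3|>0$. Suppose that $\sum_{1\le i<j\le 3}e(X_i,X_j)=6$, that $e(X_i,X_j)>0$ for all $1\le i<j\le 3$, and that $e(X_s,X_t)=1$ for some $1\le s<t\le 3$. Then one of the following holds: (i) $(|X_1|,|X_2|,|X_3|)=(5,2,1)$, $e(X_2,X_3)=1$ and $\langle X_2\rangle\cong P_2$; (ii) $(|X_1|,|X_2|,|X_3|)=(4,3,1)$, $e(X_1,X_3)=1$ and $\langle X_1\rangle\cong C_4$.
   Context: $G_3$ is the 3-dimensional locally twisted cube: vertex set $\{0,1\}^3$ and the 12 edges $000\text{ - }001$, $001\text{ - }011$, $011\text{ - }010$, $010\text{ - }000$, $100\text{ - }101$, $101\text{ - }111$, $111\text{ - }110$, $110\text{ - }100$, $000\text{ - }100$, $010\text{ - }110$, $001\text{ - }111$, $011\text{ - }101$. For vertex sets $X,Y$, $e(X,Y)$ is the number of edges with one end in $X$ and the other in $Y$; $\langle S\rangle$ is the induced subgraph on $S$; $P_2$ is the path on 2 vertices and $C_4$ the 4-cycle. -}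

module Defs where

open import Data.Bool using (Bool; true; false; _∧_; _∨_; if_then_else_)
open import Data.Nat using (ℕ; zero; suc; _+_)
open import Data.Fin using (Fin; zero; suc)
open import Data.Product using (_×_; _,_; Σ; ∃)
open import Data.Sum using (_⊎_)
open import Data.List using (List; []; _∷_; length; filter)
open import Data.List.Membership.Propositional using (_∈_)
open import Relation.Binary.PropositionalEquality using (_≡_)
open import Function.Definitions using (Injective)
open import Function.Bundles using (_⇔_)

-- Vertices of G_3 : bit strings of length 3, written (b1 , b2 , b3).
V : Set
V = Bool × Bool × Bool

allV : List V
allV = (false , false , false) ∷ (false , false , true) ∷ (false , true , false) ∷ (false , true , true)
     ∷ (true , false , false) ∷ (true , false , true) ∷ (true , true , false) ∷ (true , true , true) ∷ []

private
  b : ℕ → Bool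
  b zero = false
  b (suc _) = true

  v : ℕ → ℕ → ℕ → V
  v x y z = (b x , b y , b z)

-- The 12 edges of the locally twisted cube G_3 (each listed once).
edges : List (V × V)
edges =
    (v 0 0 0 , v 0 0 1) ∷ (v 0 0 1 , v 0 1 1) ∷ (v 0 1 1 , v 0 1 0) ∷ (v 0 1 0 , v 0 0 0)
  ∷ (v 1 0 0 , v 1 0 1) ∷ (v 1 0 1 , v 1 1 1) ∷ (v 1 1 1 , v 1 1 0) ∷ (v 1 1 0 , v 1 0 0)
  ∷ (v 0 0 0 , v 1 0 0) ∷ (v 0 1 0 , v 1 1 0) ∷ (v 0 0 1 , v 1 1 1) ∷ (v 0 1 1 , v 1 0 1)
  ∷ []

Adj : V → V → Set
Adj u w = ((u , w) ∈ edges) ⊎ ((w , u) ∈ edges)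

VSet : Set
VSet = V → Bool

_∈ₛ_ : V → VSet → Set
u ∈ₛ X = X u ≡ true

count : {A : Set} → (A → Bool) → List A → ℕ
count p [] = 0
count p (x ∷ xs) = (if p x then 1 else 0) + count p xs

card : VSet → ℕ
card X = count X allV

e : VSet → VSet → ℕ
e X Y = count (λ { (u , w) → (X u ∧ Y w) ∨ (X w ∧ Y u) }) edges

AdjP2 : Fin 2 → Fin 2 → Set
AdjP2 i j = ((i , j) ∈ es) ⊎ ((j , i) ∈ es)
  where es : List (Fin 2 × Fin 2)
        es = (zero , suc zero) ∷ []

AdjC4 : Fin 4 → Fin 4 → Set
AdjC4 i j = ((i , j) ∈ es) ⊎ ((j , i) ∈ es)
  where es : List (Fin 4 × Fin 4)
        es = (zero , suc zero) ∷ (suc zero , suc (suc zero)) ∷ (suc (suc zero) , suc (suc (suc zero)))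
           ∷ (suc (suc (suc zero)) , zero) ∷ []

InducedIso : VSet → (k : ℕ) → (Fin k → Fin k → Set) → Set
InducedIso S k AdjH =
  Σ (Fin k → V) λ f →
    Injective _≡_ _≡_ f
    × (∀ u → u ∈ₛ S ⇔ ∃ (λ i → f i ≡ u))
    × (∀ i j → AdjH i j ⇔ Adj (f i) (f j))

module Submission where

-- G₃ has only 8 vertices, so the lemma is a finite statement;
-- it is proved by a verified exhaustive search, each reduction step being a
-- separately stated fact.
--  * Decision procedures: equality of vertices, adjacency in a graph given by
--    an edge list, and quantification over the finitely many vertices.
--  * Invariance: |X|, e(X,Y) and ⟨S⟩ ≅ H depend on the sets only pointwise.
--  * A partition (X₁,X₂,X₃) of V is the block decomposition of a labelling
--    V → Fin 3, which agrees pointwise with one of an explicit list of 3⁸.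
--  * An isomorphism ⟨S⟩ ≅ H is searched for among the k-tuples of members
--    of S; whatever the search finds is a genuine isomorphism.
--  * The type checker evaluates "hypotheses ⇒ conclusion (with a searched
--    isomorphism)" on every listed labelling.

open import Defs
open import Data.Nat using (ℕ; _+_; _≥_; _>_)
open import Data.Product using (_×_)
open import Data.Sum using (_⊎_)
open import Relation.Nullary using (¬_)
open import Relation.Binary.PropositionalEquality using (_≡_)

open import Data.Bool using (Bool; true; false; _∧_; _∨_; if_then_else_; T?)
import Data.Bool.Properties as Bool
import Data.Nat as ℕ
open import Data.Fin using (Fin; #_)
open import Data.Fin.Patterns using (0F; 1F; 2F)
import Data.Fin.Properties as Fin
open import Data.Product using (∃; _,_; uncurry)
import Data.Product as Product
open import Data.Product.Properties using (≡-dec)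
open import Data.Sum using (inj₁; inj₂)
import Data.Sum as Sum
open import Data.List using (List; []; _∷_; map; filter; cartesianProductWith; allFin)
open import Data.List.Membership.Propositional using (_∈_)
open import Data.List.Membership.Propositional.Properties using (∈-map⁺; ∈-cartesianProductWith⁺; ∈-allFin)
import Data.List.Membership.DecPropositional as DecMembership
open import Data.List.Relation.Unary.All as All using (All; all?)
open import Data.List.Relation.Unary.Any as Any using (Any; any?; here; there)
open import Data.Vec using (Vec; []; _∷_; lookup)
import Data.Vec as Vec
open import Data.Unit using (tt)
open import Data.Empty using (⊥-elim)
open import Function using (_∘_)
open import Relation.Nullary using (Dec; does; _×-dec_; _⊎-dec_; _→-dec_; map′)
open import Relation.Nullary.Decidable using (toWitness)
open import Relation.Binary.Definitions using (DecidableEquality)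
open import Relation.Binary.PropositionalEquality using (refl; sym; trans; cong; cong₂; subst; _≗_)
open import Function.Bundles using (_⇔_; mk⇔; Equivalence)
open import Function.Definitions using (Injective)

_≟ᵥ_ : DecidableEquality V
_≟ᵥ_ = ≡-dec Bool._≟_ (≡-dec Bool._≟_ Bool._≟_)

edgeAdjacency? : {A : Set} → DecidableEquality A → (es : List (A × A))
               → (i j : A) → Dec ((i , j) ∈ es ⊎ (j , i) ∈ es)
edgeAdjacency? _≟_ es i j = member? (i , j) es ⊎-dec member? (j , i) es
  where open DecMembership (≡-dec _≟_ _≟_) renaming (_∈?_ to member?)

adj? : (u w : V) → Dec (Adj u w)
adj? = edgeAdjacency? _≟ᵥ_ edges

adjP2? : (i j : Fin 2) → Dec (AdjP2 i j)
adjP2? = edgeAdjacency? Fin._≟_ _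

adjC4? : (i j : Fin 4) → Dec (AdjC4 i j)
adjC4? = edgeAdjacency? Fin._≟_ _

∈-allV : (u : V) → u ∈ allV
∈-allV (false , false , false) = here refl
∈-allV (false , false , true)  = there (here refl)
∈-allV (false , true  , false) = there (there (here refl))
∈-allV (false , true  , true)  = there (there (there (here refl)))
∈-allV (true  , false , false) = there (there (there (there (here refl))))
∈-allV (true  , false , true)  = there (there (there (there (there (here refl)))))
∈-allV (true  , true  , false) = there (there (there (there (there (there (here refl))))))
∈-allV (true  , true  , true)  = there (there (there (there (there (there (there (here refl)))))))

∀V? : {P : V → Set} → ((u : V) → Dec (P u)) → Dec ((u : V) → P u)
∀V? P? = map′ (λ all u → All.lookup all (∈-allV u)) (λ all → All.tabulate (λ {u} _ → all u))
              (all? P? allV)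

_⇔?_ : {A B : Set} → Dec A → Dec B → Dec (A ⇔ B)
a? ⇔? b? = map′ (uncurry mk⇔) (λ eq → Equivalence.to eq , Equivalence.from eq)
                ((a? →-dec b?) ×-dec (b? →-dec a?))

vectors : {A : Set} → List A → (n : ℕ) → List (Vec A n)
vectors xs ℕ.zero    = [] ∷ []
vectors xs (ℕ.suc n) = cartesianProductWith _∷_ xs (vectors xs n)

∈-vectors : {A : Set} {xs : List A} → ((x : A) → x ∈ xs)
          → {n : ℕ} (v : Vec A n) → v ∈ vectors xs n
∈-vectors complete []      = here refl
∈-vectors complete (x ∷ v) = ∈-cartesianProductWith⁺ _∷_ (complete x) (∈-vectors complete v)

sym-≗ : {A B : Set} {f g : A → B} → f ≗ g → g ≗ f
sym-≗ f≗g x = sym (f≗g x)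

count-cong : {A : Set} {p q : A → Bool} → p ≗ q → (xs : List A) → count p xs ≡ count q xs
count-cong p≗q []       = refl
count-cong p≗q (x ∷ xs) = cong₂ (λ b n → (if b then 1 else 0) + n) (p≗q x) (count-cong p≗q xs)

card-cong : {X Y : VSet} → X ≗ Y → card X ≡ card Y
card-cong X≗Y = count-cong X≗Y allV

e-cong : {X X′ Y Y′ : VSet} → X ≗ X′ → Y ≗ Y′ → e X Y ≡ e X′ Y′
e-cong {X} {X′} {Y} {Y′} X≗X′ Y≗Y′ = count-cong crossing edges
  where
  crossing : (λ { (u , w) → (X u ∧ Y w) ∨ (X w ∧ Y u) })
           ≗ (λ { (u , w) → (X′ u ∧ Y′ w) ∨ (X′ w ∧ Y′ u) })
  crossing (u , w) = cong₂ _∨_ (cong₂ _∧_ (X≗X′ u) (Y≗Y′ w)) (cong₂ _∧_ (X≗X′ w) (Y≗Y′ u))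

-- The conditions saying that f : Fin k → V is an isomorphism H ≅ ⟨S⟩;
-- InducedIso S k H is by definition Σ f (InducedIsoVia S k H f).
InducedIsoVia : VSet → (k : ℕ) → (Fin k → Fin k → Set) → (Fin k → V) → Set
InducedIsoVia S k H f = Injective _≡_ _≡_ f
  × (∀ u → u ∈ₛ S ⇔ ∃ (λ i → f i ≡ u))
  × (∀ i j → H i j ⇔ Adj (f i) (f j))

InducedIso-cong : {S T : VSet} {k : ℕ} {H : Fin k → Fin k → Set}
                → S ≗ T → InducedIso S k H → InducedIso T k H
InducedIso-cong S≗T (f , injective , members , adjacency) =
  f , injective , (λ u → mk⇔ (λ u∈T → Equivalence.to (members u) (trans (S≗T u) u∈T))
                             (λ u∈f → trans (sym (S≗T u)) (Equivalence.from (members u) u∈f)))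
    , adjacency

inducedIsoVia? : (S : VSet) (k : ℕ) {H : Fin k → Fin k → Set}
               → ((i j : Fin k) → Dec (H i j)) → (f : Fin k → V) → Dec (InducedIsoVia S k H f)
inducedIsoVia? S k H? f =
  map′ (λ inj {i} {j} → inj i j) (λ inj i j → inj {i} {j})
       (Fin.all? λ i → Fin.all? λ j → (f i ≟ᵥ f j) →-dec (i Fin.≟ j))
  ×-dec ∀V? (λ u → (S u Bool.≟ true) ⇔? Fin.any? (λ i → f i ≟ᵥ u))
  ×-dec Fin.all? (λ i → Fin.all? λ j → H? i j ⇔? adj? (f i) (f j))

members : VSet → List V
members S = filter (T? ∘ S) allV

IsoFound : VSet → (k : ℕ) → (Fin k → Fin k → Set) → Set
IsoFound S k H = Any (λ v → InducedIsoVia S k H (lookup v)) (vectors (members S) k)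

isoFound? : (S : VSet) (k : ℕ) {H : Fin k → Fin k → Set}
          → ((i j : Fin k) → Dec (H i j)) → Dec (IsoFound S k H)
isoFound? S k H? = any? (λ v → inducedIsoVia? S k H? (lookup v)) (vectors (members S) k)

isoFound⇒InducedIso : {S : VSet} {k : ℕ} {H : Fin k → Fin k → Set}
                    → IsoFound S k H → InducedIso S k H
isoFound⇒InducedIso found with Any.satisfied found
... | v , iso = lookup v , iso

Labelling : Set
Labelling = V → Fin 3

block : Labelling → Fin 3 → VSet
block c i u = does (c u Fin.≟ i)

block-cong : {c c′ : Labelling} → c ≗ c′ → (i : Fin 3) → block c i ≗ block c′ i
block-cong c≗c′ i u = cong (λ j → does (j Fin.≟ i)) (c≗c′ u)

Disjoint : VSet → VSet → Set
Disjoint X Y = ∀ u → ¬ (u ∈ₛ X × u ∈ₛ Y)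

Blocks : Labelling → VSet → VSet → VSet → Set
Blocks c X₁ X₂ X₃ = X₁ ≗ block c 0F × X₂ ≗ block c 1F × X₃ ≗ block c 2F

-- The index of the first of three sets containing a vertex, given its two
-- first membership bits (the third set is whatever remains).
blockIndex : Bool → Bool → Fin 3
blockIndex true  _     = 0F
blockIndex false true  = 1F
blockIndex false false = 2F

partition⇒Blocks : (X₁ X₂ X₃ : VSet) → Disjoint X₁ X₂ → Disjoint X₁ X₃ → Disjoint X₂ X₃
                 → (∀ u → u ∈ₛ X₁ ⊎ u ∈ₛ X₂ ⊎ u ∈ₛ X₃)
                 → Blocks (λ u → blockIndex (X₁ u) (X₂ u)) X₁ X₂ X₃
partition⇒Blocks X₁ X₂ X₃ d₁₂ d₁₃ d₂₃ cover =
  (λ u → first (X₁ u) (X₂ u)) ,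
  (λ u → second (X₁ u) (X₂ u) (d₁₂ u)) ,
  (λ u → third (X₁ u) (X₂ u) (X₃ u) (d₁₃ u) (d₂₃ u) (cover u))
  where
  first : ∀ a b → a ≡ does (blockIndex a b Fin.≟ 0F)
  first true  _     = refl
  first false true  = refl
  first false false = refl
  second : ∀ a b → ¬ (a ≡ true × b ≡ true) → b ≡ does (blockIndex a b Fin.≟ 1F)
  second true  true  a∩b = ⊥-elim (a∩b (refl , refl))
  second true  false _   = refl
  second false true  _   = refl
  second false false _   = refl
  third : ∀ a b c → ¬ (a ≡ true × c ≡ true) → ¬ (b ≡ true × c ≡ true)
        → a ≡ true ⊎ b ≡ true ⊎ c ≡ true → c ≡ does (blockIndex a b Fin.≟ 2F)
  third true  _     true  a∩c _   _ = ⊥-elim (a∩c (refl , refl))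
  third true  _     false _   _   _ = refl
  third false true  true  _   b∩c _ = ⊥-elim (b∩c (refl , refl))
  third false true  false _   _   _ = refl
  third false false true  _   _   _ = refl
  third false false false _   _   (inj₁ ())
  third false false false _   _   (inj₂ (inj₁ ()))
  third false false false _   _   (inj₂ (inj₂ ()))

-- A labelling is determined by its table of values along allV: position u is
-- the index of u in allV, so reading the table at position u gives back c u.
position : V → Fin 8
position (false , false , false) = # 0
position (false , false , true)  = # 1
position (false , true  , false) = # 2
position (false , true  , true)  = # 3
position (true  , false , false) = # 4
position (true  , false , true)  = # 5
position (true  , true  , false) = # 6
position (true  , true  , true)  = # 7

table : Labelling → Vec (Fin 3) 8
table c = Vec.map c (Vec.fromList allV)

fromTable : Vec (Fin 3) 8 → Labelling
fromTable t u = lookup t (position u)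

fromTable-table : (c : Labelling) → fromTable (table c) ≗ c
fromTable-table c (false , false , false) = refl
fromTable-table c (false , false , true)  = refl
fromTable-table c (false , true  , false) = refl
fromTable-table c (false , true  , true)  = refl
fromTable-table c (true  , false , false) = refl
fromTable-table c (true  , false , true)  = refl
fromTable-table c (true  , true  , false) = refl
fromTable-table c (true  , true  , true)  = refl

labellings : List Labelling
labellings = map fromTable (vectors (allFin 3) 8)

labellings-complete : (c : Labelling) → ∃ λ l → l ∈ labellings × l ≗ c
labellings-complete c =
  fromTable (table c) , ∈-map⁺ fromTable (∈-vectors ∈-allFin (table c)) , fromTable-table c

Blocks-cong : {c c′ : Labelling} {X₁ X₂ X₃ : VSet} → c ≗ c′ → Blocks c X₁ X₂ X₃ → Blocks c′ X₁ X₂ X₃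
Blocks-cong c≗c′ (b₁ , b₂ , b₃) =
  (λ u → trans (b₁ u) (block-cong c≗c′ 0F u)) ,
  (λ u → trans (b₂ u) (block-cong c≗c′ 1F u)) ,
  (λ u → trans (b₃ u) (block-cong c≗c′ 2F u))

partition⇒listedBlocks : (X₁ X₂ X₃ : VSet) → Disjoint X₁ X₂ → Disjoint X₁ X₃ → Disjoint X₂ X₃
                       → (∀ u → u ∈ₛ X₁ ⊎ u ∈ₛ X₂ ⊎ u ∈ₛ X₃)
                       → ∃ λ l → l ∈ labellings × Blocks l X₁ X₂ X₃
partition⇒listedBlocks X₁ X₂ X₃ d₁₂ d₁₃ d₂₃ cover = listed (labellings-complete c)
  where
  c : Labelling
  c u = blockIndex (X₁ u) (X₂ u)
  listed : (∃ λ l → l ∈ labellings × l ≗ c) → ∃ λ l → l ∈ labellings × Blocks l X₁ X₂ X₃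
  listed (l , l∈labellings , l≗c) =
    l , l∈labellings , Blocks-cong (sym-≗ l≗c) (partition⇒Blocks X₁ X₂ X₃ d₁₂ d₁₃ d₂₃ cover)

record Profile : Set where
  constructor ⟨_,_,_∣_,_,_⟩
  field
    n₁ n₂ n₃ e₁₂ e₁₃ e₂₃ : ℕ

profile : VSet → VSet → VSet → Profile
profile X₁ X₂ X₃ = ⟨ card X₁ , card X₂ , card X₃ ∣ e X₁ X₂ , e X₁ X₃ , e X₂ X₃ ⟩

profile-cong : {X₁ X₂ X₃ Y₁ Y₂ Y₃ : VSet} → X₁ ≗ Y₁ → X₂ ≗ Y₂ → X₃ ≗ Y₃
             → profile X₁ X₂ X₃ ≡ profile Y₁ Y₂ Y₃
profile-cong p₁ p₂ p₃
  rewrite card-cong p₁ | card-cong p₂ | card-cong p₃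
        | e-cong p₁ p₂ | e-cong p₁ p₃ | e-cong p₂ p₃ = refl

Admissible : Profile → Set
Admissible ⟨ n₁ , n₂ , n₃ ∣ e₁₂ , e₁₃ , e₂₃ ⟩ =
  n₁ ≥ n₂ × n₂ ≥ n₃ × n₃ > 0 × e₁₂ + e₁₃ + e₂₃ ≡ 6
  × e₁₂ > 0 × e₁₃ > 0 × e₂₃ > 0 × (e₁₂ ≡ 1 ⊎ e₁₃ ≡ 1 ⊎ e₂₃ ≡ 1)

admissible? : (p : Profile) → Dec (Admissible p)
admissible? ⟨ n₁ , n₂ , n₃ ∣ e₁₂ , e₁₃ , e₂₃ ⟩ =
  n₂ ℕ.≤? n₁ ×-dec n₃ ℕ.≤? n₂ ×-dec 1 ℕ.≤? n₃ ×-dec e₁₂ + e₁₃ + e₂₃ ℕ.≟ 6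
  ×-dec 1 ℕ.≤? e₁₂ ×-dec 1 ℕ.≤? e₁₃ ×-dec 1 ℕ.≤? e₂₃
  ×-dec (e₁₂ ℕ.≟ 1 ⊎-dec e₁₃ ℕ.≟ 1 ⊎-dec e₂₃ ℕ.≟ 1)

IsoNotion : Set₁
IsoNotion = VSet → (k : ℕ) → (Fin k → Fin k → Set) → Set

Conclusion : IsoNotion → VSet → VSet → VSet → Set
Conclusion Iso X₁ X₂ X₃ =
    (card X₁ ≡ 5 × card X₂ ≡ 2 × card X₃ ≡ 1 × e X₂ X₃ ≡ 1 × Iso X₂ 2 AdjP2)
  ⊎ (card X₁ ≡ 4 × card X₂ ≡ 3 × card X₃ ≡ 1 × e X₁ X₃ ≡ 1 × Iso X₁ 4 AdjC4)

conclusion? : (X₁ X₂ X₃ : VSet) → Dec (Conclusion IsoFound X₁ X₂ X₃)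
conclusion? X₁ X₂ X₃ =
  (card X₁ ℕ.≟ 5 ×-dec card X₂ ℕ.≟ 2 ×-dec card X₃ ℕ.≟ 1 ×-dec e X₂ X₃ ℕ.≟ 1
    ×-dec isoFound? X₂ 2 adjP2?)
  ⊎-dec
  (card X₁ ℕ.≟ 4 ×-dec card X₂ ℕ.≟ 3 ×-dec card X₃ ℕ.≟ 1 ×-dec e X₁ X₃ ℕ.≟ 1
    ×-dec isoFound? X₁ 4 adjC4?)

Conclusion-transfer : {Iso Iso′ : IsoNotion} {X₁ X₂ X₃ Y₁ Y₂ Y₃ : VSet}
  → (∀ {S T k H} → S ≗ T → Iso S k H → Iso′ T k H)
  → X₁ ≗ Y₁ → X₂ ≗ Y₂ → X₃ ≗ Y₃
  → Conclusion Iso X₁ X₂ X₃ → Conclusion Iso′ Y₁ Y₂ Y₃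
Conclusion-transfer transfer p₁ p₂ p₃
  rewrite card-cong p₁ | card-cong p₂ | card-cong p₃ | e-cong p₂ p₃ | e-cong p₁ p₃ =
  Sum.map (Product.map₂ (Product.map₂ (Product.map₂ (Product.map₂ (transfer p₂)))))
          (Product.map₂ (Product.map₂ (Product.map₂ (Product.map₂ (transfer p₁)))))

Lemma : IsoNotion → VSet → VSet → VSet → Set
Lemma Iso X₁ X₂ X₃ = Admissible (profile X₁ X₂ X₃) → Conclusion Iso X₁ X₂ X₃

lemma? : (X₁ X₂ X₃ : VSet) → Dec (Lemma IsoFound X₁ X₂ X₃)
lemma? X₁ X₂ X₃ = admissible? (profile X₁ X₂ X₃) →-dec conclusion? X₁ X₂ X₃

Checked : Labelling → Set
Checked c = Lemma IsoFound (block c 0F) (block c 1F) (block c 2F)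

checked? : (c : Labelling) → Dec (Checked c)
checked? c = lemma? (block c 0F) (block c 1F) (block c 2F)

-- Evaluated by the type checker on all 3⁸ listed labellings.
all-checked : All Checked labellings
all-checked = toWitness {a? = all? checked? labellings} tt

lemma2p6 : (X₁ X₂ X₃ : VSet)
    → (∀ u → ¬ (u ∈ₛ X₁ × u ∈ₛ X₂))
    → (∀ u → ¬ (u ∈ₛ X₁ × u ∈ₛ X₃))
    → (∀ u → ¬ (u ∈ₛ X₂ × u ∈ₛ X₃))
    → (∀ u → u ∈ₛ X₁ ⊎ u ∈ₛ X₂ ⊎ u ∈ₛ X₃)
    → card X₁ ≥ card X₂ → card X₂ ≥ card X₃ → card X₃ > 0
    → e X₁ X₂ + e X₁ X₃ + e X₂ X₃ ≡ 6
    → e X₁ X₂ > 0 → e X₁ X₃ > 0 → e X₂ X₃ > 0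
    → (e X₁ X₂ ≡ 1 ⊎ e X₁ X₃ ≡ 1 ⊎ e X₂ X₃ ≡ 1)
    → (card X₁ ≡ 5 × card X₂ ≡ 2 × card X₃ ≡ 1 × e X₂ X₃ ≡ 1 × InducedIso X₂ 2 AdjP2)
    ⊎ (card X₁ ≡ 4 × card X₂ ≡ 3 × card X₃ ≡ 1 × e X₁ X₃ ≡ 1 × InducedIso X₁ 4 AdjC4)
lemma2p6 X₁ X₂ X₃ d₁₂ d₁₃ d₂₃ cover n₁≥n₂ n₂≥n₃ n₃>0 sum≡6 e₁₂>0 e₁₃>0 e₂₃>0 some≡1 =
  conclude (partition⇒listedBlocks X₁ X₂ X₃ d₁₂ d₁₃ d₂₃ cover)
  where
  admissible : Admissible (profile X₁ X₂ X₃)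
  admissible = n₁≥n₂ , n₂≥n₃ , n₃>0 , sum≡6 , e₁₂>0 , e₁₃>0 , e₂₃>0 , some≡1
  -- Transfer the hypotheses to the blocks of a listed labelling l, apply the
  -- exhaustive check there, and transfer the conclusion back.
  conclude : (∃ λ l → l ∈ labellings × Blocks l X₁ X₂ X₃) → Conclusion InducedIso X₁ X₂ X₃
  conclude (l , l∈labellings , q₁ , q₂ , q₃) =
    Conclusion-transfer {IsoFound} {InducedIso}
      (λ S≗T found → InducedIso-cong S≗T (isoFound⇒InducedIso found))
      (sym-≗ q₁) (sym-≗ q₂) (sym-≗ q₃)
      (All.lookup all-checked l∈labellings (subst Admissible (profile-cong q₁ q₂ q₃) admissible))
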